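{- Let $\mathcal{Y}$ be an $m\times n$ zero-nonzero pattern and let $G$ be the cobipartite graph associated with $\mathcal{Y}$. If $G$ is saturated with respect to the corresponding clique partition, then $Z(G) = m+n-\operatorname{tri}(\mathcal{Y})$.
   Context: A zero-nonzero pattern is a matrix with entries in $\{0,*\}$; a square pattern is a triangle if some permutation of its rows followed by some independent permutation of its columns yields a lower-triangular pattern with only $*$ entries on the diagonal; $\operatorname{tri}(\mathcal{Y})$ is the largest size of a square submatrix of $\mathcal{Y}$ that is a triangle. The cobipartite graph associated with $\mathcal{Y}$ is the simple graph on vertex set $V_r\cup V_c$ with $V_r=\{r_1,\dots,r_m\}$, $V_c=\{c_1,\dots,c_n\}$ disjoint, in which $V_r$ and $V_c$ are each cliques and $r_i$ is adjacent to $c_j$ exactly when the $(i,j)$ entry of $\mathcal{Y}$ is $*$; $(V_r,V_c)$ is the corresponding clique partition. $G$ is saturated with respect to $(V_r,V_c)$ if every vertex of $V_r$ has a neighbor in $V_c$ and every vertex of $V_c$ has a neighbor in $V_r$. $Z(G)$ is the zero forcing number: the smallest size of a set $F$ of initially filled vertices such that repeatedly applying the rule "a filled vertex whose only unfilled neighbor is $u$ forces $u$ to become filled" eventually fills all vertices. -}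

module Defs where

open import Data.Nat using (ℕ; zero; suc; _+_; _≤_)
open import Data.Bool using (Bool; true; false; if_then_else_)
open import Data.Fin using (Fin; _<_)
open import Data.Sum using (_⊎_; inj₁; inj₂)
open import Data.Product using (Σ; ∃; ∃-syntax; _×_; _,_)
open import Relation.Binary.PropositionalEquality using (_≡_; _≢_)
open import Function.Definitions using (Injective)

-- A zero-nonzero pattern of size m × n: entry true means *, false means 0.
Pattern : ℕ → ℕ → Set
Pattern m n = Fin m → Fin n → Bool

Vertex : ℕ → ℕ → Set
Vertex m n = Fin m ⊎ Fin n

Adj : ∀ {m n} → Pattern m n → Vertex m n → Vertex m n → Set
Adj Y (inj₁ i) (inj₁ i') = i ≢ i'
Adj Y (inj₂ j) (inj₂ j') = j ≢ j'
Adj Y (inj₁ i) (inj₂ j)  = Y i j ≡ true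
Adj Y (inj₂ j) (inj₁ i)  = Y i j ≡ true

Saturated : ∀ {m n} → Pattern m n → Set
Saturated {m} {n} Y =
  (∀ (i : Fin m) → ∃[ j ] Y i j ≡ true) × (∀ (j : Fin n) → ∃[ i ] Y i j ≡ true)

-- Vertices filled starting from the initially filled set F by repeatedly
-- applying the zero forcing rule (the final coloring is independent of order).
data Filled {m n} (Y : Pattern m n) (F : Vertex m n → Bool) : Vertex m n → Set where
  initial : ∀ {v} → F v ≡ true → Filled Y F v
  force   : ∀ {u v} → Filled Y F u → Adj Y u v →
            (∀ w → Adj Y u w → w ≢ v → Filled Y F w) →
            Filled Y F v

ZeroForcingSet : ∀ {m n} → Pattern m n → (Vertex m n → Bool) → Set
ZeroForcingSet Y F = ∀ v → Filled Y F v

countFin : ∀ {k} → (Fin k → Bool) → ℕ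
countFin {zero}  f = 0
countFin {suc k} f = (if f Fin.zero then 1 else 0) + countFin (λ i → f (Fin.suc i))

size : ∀ {m n} → (Vertex m n → Bool) → ℕ
size F = countFin (λ i → F (inj₁ i)) + countFin (λ j → F (inj₂ j))

ZeroForcingNumber : ∀ {m n} → Pattern m n → ℕ → Set
ZeroForcingNumber Y z =
  (∃[ F ] (ZeroForcingSet Y F × size F ≡ z)) ×
  (∀ F → ZeroForcingSet Y F → z ≤ size F)

-- A k × k submatrix of Y (rows r 1..k, columns c 1..k, distinct) which is a
-- triangle: after ordering its rows by r and columns by c (i.e. after the
-- row and column permutations), it is lower triangular with * diagonal.
IsTriangle : ∀ {m n} → Pattern m n → (k : ℕ) → Set
IsTriangle {m} {n} Y k =
  Σ (Fin k → Fin m) λ r → Σ (Fin k → Fin n) λ c →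
    Injective _≡_ _≡_ r × Injective _≡_ _≡_ c ×
    (∀ i → Y (r i) (c i) ≡ true) ×
    (∀ i j → i < j → Y (r i) (c j) ≡ false)

Tri : ∀ {m n} → Pattern m n → ℕ → Set
Tri Y t = IsTriangle Y t × (∀ k → IsTriangle Y k → k ≤ t)

-- Upper bound: all rows together with the columns outside a triangle (ρ , γ) form a zero forcing
-- set, since row ρ i forces column γ i as soon as the columns γ i′ with i′ < i are filled.
-- Lower bound: complete a zero forcing set F one force at a time. A vertex can only force once the
-- rest of its clique is filled, so after the first force, say from a row r, all rows are filled and
-- every later force fills a column; by saturation each of them can be taken to come from a row.
-- A row forcing a column is adjacent to no column forced after it, so the forcing pairs, in order,
-- form a triangle, to which the first force contributes one more pair (r , c), with c the forced
-- column or, if r forced a row, a filled neighbour of r. Its size is the number of forces,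
-- m + n − |F|.
module Submission where

open import Defs
open import Data.Nat using (ℕ; zero; suc; _+_; _∸_; _≤_; z≤n; s≤s)
import Data.Nat as Nat
import Data.Nat.Properties as ℕ
open import Data.Bool using (Bool; true; false; not; if_then_else_)
import Data.Bool.Properties as Bool
open import Data.Fin using (Fin; zero; suc; _<_; opposite)
import Data.Fin.Properties as Fin
open import Data.Fin.Induction using (<-wellFounded)
open import Data.Sum using (_⊎_; inj₁; inj₂; swap; [_,_]; [_,_]′)
open import Data.Sum.Properties using (≡-dec; swap-involutive; inj₁-injective; inj₂-injective)
open import Data.Product using (Σ; ∃; ∃₂; _×_; _,_; proj₁; proj₂; uncurry)
open import Function using (_∘_)
open import Function.Definitions using (Injective)
open import Induction.WellFounded using (Acc; acc)
open import Relation.Binary.Definitions using (DecidableEquality; Decidable; tri<; tri≈; tri>)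
open import Relation.Binary.PropositionalEquality
open import Relation.Nullary using (¬_; Dec; yes; no; does; contradiction)
open import Relation.Nullary.Decidable using (map′; dec-true; dec-false; ¬?; _×-dec_; _⊎-dec_; _→-dec_)
import Relation.Unary as U

private
  variable
    m n k t : ℕ

countFin-≤ : (f : Fin k → Bool) → countFin f ≤ k
countFin-≤ {zero}  f = z≤n
countFin-≤ {suc k} f with f zero
... | true  = s≤s (countFin-≤ (f ∘ suc))
... | false = ℕ.m≤n⇒m≤1+n (countFin-≤ (f ∘ suc))

countFin-full : (f : Fin k → Bool) → (∀ i → f i ≡ true) → countFin f ≡ k
countFin-full {zero}  f full = refl
countFin-full {suc k} f full rewrite full zero = cong suc (countFin-full (f ∘ suc) (full ∘ suc))

countFin-cong : {f g : Fin k → Bool} → (∀ i → f i ≡ g i) → countFin f ≡ countFin g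
countFin-cong {zero}  f≗g = refl
countFin-cong {suc k} f≗g rewrite f≗g zero = cong (_ +_) (countFin-cong (f≗g ∘ suc))

countFin-insert : (f g : Fin k → Bool) (p : Fin k) → f p ≡ false → g p ≡ true →
                  (∀ i → i ≢ p → g i ≡ f i) → countFin g ≡ suc (countFin f)
countFin-insert f g zero fp gp agree rewrite fp | gp =
  cong suc (countFin-cong λ i → agree (suc i) λ ())
countFin-insert f g (suc p) fp gp agree rewrite agree zero (λ ()) =
  trans (cong (_ +_) (countFin-insert (f ∘ suc) (g ∘ suc) p fp gp
                        λ i i≢p → agree (suc i) (i≢p ∘ Fin.suc-injective)))
        (ℕ.+-suc _ _)

countFin-not : (f : Fin k → Bool) → countFin (not ∘ f) + countFin f ≡ k
countFin-not {zero}  f = refl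
countFin-not {suc k} f with f zero
... | true  = trans (ℕ.+-suc _ _) (cong suc (countFin-not (f ∘ suc)))
... | false = cong suc (countFin-not (f ∘ suc))

countFin-injection : (f : Fin k → Bool) (c : Fin t → Fin k) → Injective _≡_ _≡_ c →
                     (∀ i → f (c i) ≡ true) → t ≤ countFin f
countFin-injection {t = zero}  f c c-inj inF = z≤n
countFin-injection {t = suc t} f c c-inj inF = begin
  suc t             ≤⟨ s≤s (countFin-injection f′ (c ∘ suc) (Fin.suc-injective ∘ c-inj) inF′) ⟩
  suc (countFin f′) ≡⟨ countFin-insert f′ f (c zero) removed (inF zero) kept ⟨
  countFin f        ∎
  where
  open ℕ.≤-Reasoning
  f′ : Fin _ → Bool
  f′ i = if does (i Fin.≟ c zero) then false else f i
  removed : f′ (c zero) ≡ false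
  removed rewrite dec-true (c zero Fin.≟ c zero) refl = refl
  kept : ∀ i → i ≢ c zero → f i ≡ f′ i
  kept i i≢c₀ rewrite dec-false (i Fin.≟ c zero) i≢c₀ = refl
  inF′ : ∀ i → f′ (c (suc i)) ≡ true
  inF′ i rewrite dec-false (c (suc i) Fin.≟ c zero) (Fin.0≢1+n ∘ sym ∘ c-inj) = inF (suc i)

_≟ᵥ_ : DecidableEquality (Vertex m n)
_≟ᵥ_ = ≡-dec Fin._≟_ Fin._≟_

all-vertices? : {P : Vertex m n → Set} → U.Decidable P → Dec (∀ v → P v)
all-vertices? P? =
  map′ (uncurry [_,_]) (λ all → all ∘ inj₁ , all ∘ inj₂) (Fin.all? (P? ∘ inj₁) ×-dec Fin.all? (P? ∘ inj₂))

any-vertex? : {P : Vertex m n → Set} → U.Decidable P → Dec (∃ P)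
any-vertex? P? =
  map′ [ (λ (i , p) → inj₁ i , p) , (λ (j , p) → inj₂ j , p) ]′
       (λ { (inj₁ i , p) → inj₁ (i , p) ; (inj₂ j , p) → inj₂ (j , p) })
       (Fin.any? (P? ∘ inj₁) ⊎-dec Fin.any? (P? ∘ inj₂))

adj? : (Y : Pattern m n) → Decidable (Adj Y)
adj? Y (inj₁ i) (inj₁ i′) = ¬? (i Fin.≟ i′)
adj? Y (inj₂ j) (inj₂ j′) = ¬? (j Fin.≟ j′)
adj? Y (inj₁ i) (inj₂ j)  = Y i j Bool.≟ true
adj? Y (inj₂ j) (inj₁ i)  = Y i j Bool.≟ true

insert : (Vertex m n → Bool) → Vertex m n → Vertex m n → Bool
insert F x w = if does (w ≟ᵥ x) then true else F w

insert-filled : (F : Vertex m n → Bool) (x w : Vertex m n) → (w ≢ x → F w ≡ true) → insert F x w ≡ true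
insert-filled F x w Fw with w ≟ᵥ x
... | yes _   = refl
... | no w≢x = Fw w≢x

insert-self : (F : Vertex m n → Bool) (x : Vertex m n) → insert F x x ≡ true
insert-self F x = insert-filled F x x (contradiction refl)

insert-⊇ : (F : Vertex m n → Bool) (x w : Vertex m n) → F w ≡ true → insert F x w ≡ true
insert-⊇ F x w Fw = insert-filled F x w λ _ → Fw

insert-other : (F : Vertex m n → Bool) (x w : Vertex m n) → w ≢ x → insert F x w ≡ F w
insert-other F x w w≢x rewrite dec-false (w ≟ᵥ x) w≢x = refl

insert-unfilled : (F : Vertex m n → Bool) (x w : Vertex m n) →
                  insert F x w ≡ false → w ≢ x × F w ≡ false
insert-unfilled F x w e with w ≟ᵥ x
... | no w≢x = w≢x , e

size-insert : (F : Vertex m n → Bool) (x : Vertex m n) → F x ≡ false → size (insert F x) ≡ suc (size F)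
size-insert F x@(inj₁ p) Fx =
  cong₂ _+_ (countFin-insert _ _ p Fx (insert-self F x) λ i i≢p → insert-other F x (inj₁ i) (i≢p ∘ inj₁-injective))
            (countFin-cong λ j → insert-other F x (inj₂ j) λ ())
size-insert F x@(inj₂ p) Fx =
  trans (cong₂ _+_ (countFin-cong λ i → insert-other F x (inj₁ i) λ ())
                   (countFin-insert _ _ p Fx (insert-self F x) λ j j≢p → insert-other F x (inj₂ j) (j≢p ∘ inj₂-injective)))
        (ℕ.+-suc _ _)

size-≤ : (F : Vertex m n → Bool) → size F ≤ m + n
size-≤ F = ℕ.+-mono-≤ (countFin-≤ (F ∘ inj₁)) (countFin-≤ (F ∘ inj₂))

size-full : (F : Vertex m n → Bool) → (∀ v → F v ≡ true) → size F ≡ m + n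
size-full F full = cong₂ _+_ (countFin-full (F ∘ inj₁) (full ∘ inj₁)) (countFin-full (F ∘ inj₂) (full ∘ inj₂))

record Forces (Y : Pattern m n) (F : Vertex m n → Bool) (u x : Vertex m n) : Set where
  field
    source-filled   : F u ≡ true
    target-unfilled : F x ≡ false
    adjacent        : Adj Y u x
    others-filled   : ∀ w → Adj Y u w → w ≢ x → F w ≡ true

forces? : (Y : Pattern m n) (F : Vertex m n → Bool) → Decidable (Forces Y F)
forces? Y F u x =
  map′ (λ (s , t , a , o) → record { source-filled = s ; target-unfilled = t ; adjacent = a ; others-filled = o })
       (λ f → let open Forces f in source-filled , target-unfilled , adjacent , others-filled)
       (F u Bool.≟ true ×-dec F x Bool.≟ false ×-dec adj? Y u x ×-dec
        all-vertices? λ w → adj? Y u w →-dec ¬? (w ≟ᵥ x) →-dec F w Bool.≟ true)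

Filled-mono : {Y : Pattern m n} {F G : Vertex m n → Bool} →
              (∀ w → F w ≡ true → G w ≡ true) → ∀ {v} → Filled Y F v → Filled Y G v
Filled-mono F⊆G (initial Fv)          = initial (F⊆G _ Fv)
Filled-mono F⊆G (force fu adj others) = force (Filled-mono F⊆G fu) adj λ w a w≢v → Filled-mono F⊆G (others w a w≢v)

zeroForcingSet-insert : {Y : Pattern m n} {F : Vertex m n → Bool} (x : Vertex m n) →
                        ZeroForcingSet Y F → ZeroForcingSet Y (insert F x)
zeroForcingSet-insert {F = F} x zfs = Filled-mono (insert-⊇ F x) ∘ zfs

stalled⇒Filled⊆F : {Y : Pattern m n} {F : Vertex m n → Bool} → ¬ ∃₂ (Forces Y F) →
                   ∀ {v} → Filled Y F v → F v ≡ true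
stalled⇒Filled⊆F stalled (initial Fv) = Fv
stalled⇒Filled⊆F {F = F} stalled (force {u} {v} fu adj others) with F v in Fv
... | true  = refl
... | false = contradiction
  (u , v , record { source-filled = stalled⇒Filled⊆F stalled fu ; target-unfilled = Fv ; adjacent = adj
                  ; others-filled = λ w a w≢v → stalled⇒Filled⊆F stalled (others w a w≢v) })
  stalled

zeroForcingSet-full-or-forces : {Y : Pattern m n} {F : Vertex m n → Bool} → ZeroForcingSet Y F →
                                (∀ v → F v ≡ true) ⊎ ∃₂ (Forces Y F)
zeroForcingSet-full-or-forces {Y = Y} {F} zfs with any-vertex? (λ u → any-vertex? (forces? Y F u))
... | yes u⇒x    = inj₂ u⇒x
... | no stalled = inj₁ (stalled⇒Filled⊆F stalled ∘ zfs)

module _ (Y : Pattern m n) where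

  triangleColumns : IsTriangle Y k → Fin k → Fin n
  triangleColumns (_ , γ , _) = γ

  UnfilledColumns : (Vertex m n → Bool) → IsTriangle Y k → Set
  UnfilledColumns F T = ∀ s → F (inj₂ (triangleColumns T s)) ≡ false

  emptyTriangle : IsTriangle Y 0
  emptyTriangle = (λ ()) , (λ ()) , (λ {}) , (λ {}) , (λ ()) , (λ ())

  prepend : (r : Fin m) (c : Fin n) (T : IsTriangle Y k) → Y r c ≡ true →
            (∀ s → Y r (triangleColumns T s) ≡ false) → (∀ s → c ≢ triangleColumns T s) →
            IsTriangle Y (suc k)
  prepend {k} r c (ρ , γ , ρ-inj , γ-inj , diag , upper) rc r-misses c-fresh =
    ρ′ , γ′ , ρ′-inj , γ′-inj , diag′ , upper′
    where
    ρ′ : Fin (suc k) → Fin m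
    ρ′ zero    = r
    ρ′ (suc s) = ρ s
    γ′ : Fin (suc k) → Fin n
    γ′ zero    = c
    γ′ (suc s) = γ s
    r-fresh : ∀ s → r ≢ ρ s
    r-fresh s r≡ρs = Bool.not-¬ (diag s) (trans (cong (λ i → Y i (γ s)) (sym r≡ρs)) (r-misses s))
    ρ′-inj : Injective _≡_ _≡_ ρ′
    ρ′-inj {zero}  {zero}   _ = refl
    ρ′-inj {zero}  {suc s}  e = contradiction e (r-fresh s)
    ρ′-inj {suc s} {zero}   e = contradiction (sym e) (r-fresh s)
    ρ′-inj {suc s} {suc s′} e = cong suc (ρ-inj e)
    γ′-inj : Injective _≡_ _≡_ γ′
    γ′-inj {zero}  {zero}   _ = refl
    γ′-inj {zero}  {suc s}  e = contradiction e (c-fresh s)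
    γ′-inj {suc s} {zero}   e = contradiction (sym e) (c-fresh s)
    γ′-inj {suc s} {suc s′} e = cong suc (γ-inj e)
    diag′ : ∀ s → Y (ρ′ s) (γ′ s) ≡ true
    diag′ zero    = rc
    diag′ (suc s) = diag s
    upper′ : ∀ s s′ → s < s′ → Y (ρ′ s) (γ′ s′) ≡ false
    upper′ zero    (suc s′) _          = r-misses s′
    upper′ (suc s) (suc s′) (s≤s s<s′) = upper s s′ s<s′

  prepend-forcing-row : {F : Vertex m n → Bool} {r : Fin m} {x : Vertex m n} {c : Fin n} →
                        Forces Y F (inj₁ r) x → Y r c ≡ true → insert F x (inj₂ c) ≡ true →
                        (T : IsTriangle Y k) → UnfilledColumns (insert F x) T → IsTriangle Y (suc k)
  prepend-forcing-row {F = F} {r} {x} {c} r⇒x rc c-filled T unfilled = prepend r c T rc r-misses c-fresh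
    where
    r-misses : ∀ s → Y r (triangleColumns T s) ≡ false
    r-misses s with Y r (triangleColumns T s) in adj | insert-unfilled F x _ (unfilled s)
    ... | false | _            = refl
    ... | true  | γs≢x , Fγs≡f = contradiction (Forces.others-filled r⇒x _ adj γs≢x) (Bool.not-¬ Fγs≡f)
    c-fresh : ∀ s → c ≢ triangleColumns T s
    c-fresh s c≡γs = Bool.not-¬ c-filled (trans (cong (insert F x ∘ inj₂) c≡γs) (unfilled s))

  RowsFilled : (Vertex m n → Bool) → Set
  RowsFilled F = ∀ i → F (inj₁ i) ≡ true

  column-forcing⇒row-forcing : {F : Vertex m n → Bool} {u : Vertex m n} {c : Fin n} → Saturated Y →
                               RowsFilled F → Forces Y F u (inj₂ c) → ∃ λ r → Forces Y F (inj₁ r) (inj₂ c)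
  column-forcing⇒row-forcing {u = inj₁ r} _ _ r⇒c = r , r⇒c
  column-forcing⇒row-forcing {F = F} {inj₂ c′} {c} (_ , col-sat) rows c′⇒c =
    ρ , record { source-filled = rows ρ ; target-unfilled = target-unfilled
               ; adjacent = ρc ; others-filled = others }
    where
    open Forces c′⇒c
    ρ  = proj₁ (col-sat c)
    ρc = proj₂ (col-sat c)
    others : ∀ w → Adj Y (inj₁ ρ) w → w ≢ inj₂ c → F w ≡ true
    others (inj₁ i) _ _ = rows i
    others (inj₂ j) _ j≢c with j Fin.≟ c′
    ... | yes refl = source-filled
    ... | no j≢c′  = others-filled (inj₂ j) (j≢c′ ∘ sym) j≢c

  rowsFilled⇒triangle : {F : Vertex m n → Bool} → Saturated Y → (d : ℕ) → ZeroForcingSet Y F → RowsFilled F →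
                        d + size F ≡ m + n → Σ (IsTriangle Y d) (UnfilledColumns F)
  rowsFilled⇒triangle _ zero _ _ _ = emptyTriangle , λ ()
  rowsFilled⇒triangle {F} sat (suc d) zfs rows d+|F|≡ with zeroForcingSet-full-or-forces zfs
  ... | inj₁ full = contradiction (trans (size-full F full) (sym d+|F|≡)) (ℕ.m≢1+n+m (size F) {d})
  ... | inj₂ (_ , inj₁ i , u⇒i) = contradiction (rows i) (Bool.not-¬ (Forces.target-unfilled u⇒i))
  ... | inj₂ (_ , inj₂ c , u⇒c) with column-forcing⇒row-forcing sat rows u⇒c
  ... | r , r⇒c =
    let T , unfilled = rowsFilled⇒triangle sat d (zeroForcingSet-insert (inj₂ c) zfs)
                                           (λ i → insert-⊇ F (inj₂ c) (inj₁ i) (rows i)) d+|F′|≡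
    in prepend-forcing-row r⇒c (Forces.adjacent r⇒c) (insert-self F (inj₂ c)) T unfilled ,
       λ { zero → Forces.target-unfilled r⇒c ; (suc s) → proj₂ (insert-unfilled F (inj₂ c) _ (unfilled s)) }
    where
    d+|F′|≡ : d + size (insert F (inj₂ c)) ≡ m + n
    d+|F′|≡ = trans (cong (d +_) (size-insert F (inj₂ c) (Forces.target-unfilled u⇒c)))
                    (trans (ℕ.+-suc d (size F)) d+|F|≡)

  row-forcing⇒rowsFilled : {F : Vertex m n → Bool} {r : Fin m} {x : Vertex m n} →
                           Forces Y F (inj₁ r) x → RowsFilled (insert F x)
  row-forcing⇒rowsFilled {F} {r} {x} r⇒x i with i Fin.≟ r
  ... | yes refl = insert-⊇ F x _ (Forces.source-filled r⇒x)
  ... | no i≢r   = insert-filled F x _ (Forces.others-filled r⇒x (inj₁ i) (i≢r ∘ sym))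

  row-forcing⇒filled-neighbour : {F : Vertex m n → Bool} {r : Fin m} {x : Vertex m n} → Saturated Y →
                                 Forces Y F (inj₁ r) x → ∃ λ c → Y r c ≡ true × insert F x (inj₂ c) ≡ true
  row-forcing⇒filled-neighbour {F} {x = inj₂ c} _ r⇒c = c , Forces.adjacent r⇒c , insert-self F (inj₂ c)
  row-forcing⇒filled-neighbour {F} {r} {inj₁ r′} (row-sat , _) r⇒r′ =
    c , rc , insert-⊇ F (inj₁ r′) (inj₂ c) (Forces.others-filled r⇒r′ (inj₂ c) rc λ ())
    where
    c  = proj₁ (row-sat r)
    rc = proj₂ (row-sat r)

  row-forcing⇒triangle : {F : Vertex m n → Bool} {r : Fin m} {x : Vertex m n} → Saturated Y →
                         ZeroForcingSet Y F → Forces Y F (inj₁ r) x → ∃ λ k → IsTriangle Y k × k + size F ≡ m + n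
  row-forcing⇒triangle {F} {r} {x} sat zfs r⇒x =
    let T , unfilled = rowsFilled⇒triangle sat d (zeroForcingSet-insert x zfs) (row-forcing⇒rowsFilled r⇒x)
                                           (ℕ.m∸n+n≡m (size-≤ F′))
        c , rc , c-filled = row-forcing⇒filled-neighbour sat r⇒x
    in suc d , prepend-forcing-row r⇒x rc c-filled T unfilled , suc-d+|F|≡
    where
    F′ = insert F x
    d  = m + n ∸ size F′
    suc-d+|F|≡ : suc d + size F ≡ m + n
    suc-d+|F|≡ = begin
      suc d + size F   ≡⟨ ℕ.+-suc d (size F) ⟨
      d + suc (size F) ≡⟨ cong (d +_) (size-insert F x (Forces.target-unfilled r⇒x)) ⟨
      d + size F′      ≡⟨ ℕ.m∸n+n≡m (size-≤ F′) ⟩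
      m + n            ∎
      where open ≡-Reasoning

_ᵀ : Pattern m n → Pattern n m
(Y ᵀ) j i = Y i j

swap-≡ : {A B : Set} {w : B ⊎ A} {x : A ⊎ B} → swap w ≡ x → w ≡ swap x
swap-≡ {w = w} refl = sym (swap-involutive w)

Adj-transpose : (Y : Pattern m n) (u v : Vertex m n) → Adj Y u v → Adj (Y ᵀ) (swap u) (swap v)
Adj-transpose Y (inj₁ _) (inj₁ _) a = a
Adj-transpose Y (inj₁ _) (inj₂ _) a = a
Adj-transpose Y (inj₂ _) (inj₁ _) a = a
Adj-transpose Y (inj₂ _) (inj₂ _) a = a

Adj-transpose⁻ : (Y : Pattern m n) (u : Vertex m n) (w : Vertex n m) → Adj (Y ᵀ) (swap u) w → Adj Y u (swap w)
Adj-transpose⁻ Y (inj₁ _) (inj₁ _) a = a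
Adj-transpose⁻ Y (inj₁ _) (inj₂ _) a = a
Adj-transpose⁻ Y (inj₂ _) (inj₁ _) a = a
Adj-transpose⁻ Y (inj₂ _) (inj₂ _) a = a

Filled-transpose : {Y : Pattern m n} {F : Vertex m n → Bool} {v : Vertex m n} →
                   Filled Y F v → Filled (Y ᵀ) (F ∘ swap) (swap v)
Filled-transpose {F = F} {v} (initial Fv) = initial (trans (cong F (swap-involutive v)) Fv)
Filled-transpose {Y = Y} {F} {v} (force {u} fu a others) =
  force (Filled-transpose fu) (Adj-transpose Y u v a) λ w a′ w≢v →
    subst (Filled (Y ᵀ) (F ∘ swap)) (swap-involutive w)
          (Filled-transpose (others (swap w) (Adj-transpose⁻ Y u w a′) (w≢v ∘ swap-≡)))

zeroForcingSet-transpose : {Y : Pattern m n} {F : Vertex m n → Bool} →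
                           ZeroForcingSet Y F → ZeroForcingSet (Y ᵀ) (F ∘ swap)
zeroForcingSet-transpose {Y = Y} {F} zfs v =
  subst (Filled (Y ᵀ) (F ∘ swap)) (swap-involutive v) (Filled-transpose (zfs (swap v)))

Forces-transpose : {Y : Pattern m n} {F : Vertex m n → Bool} {u x : Vertex m n} →
                   Forces Y F u x → Forces (Y ᵀ) (F ∘ swap) (swap u) (swap x)
Forces-transpose {Y = Y} {F} {u} {x} u⇒x = record
  { source-filled   = trans (cong F (swap-involutive u)) source-filled
  ; target-unfilled = trans (cong F (swap-involutive x)) target-unfilled
  ; adjacent        = Adj-transpose Y u x adjacent
  ; others-filled   = λ w a w≢x → others-filled (swap w) (Adj-transpose⁻ Y u w a) (w≢x ∘ swap-≡)
  }
  where open Forces u⇒x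

size-transpose : (F : Vertex m n → Bool) → size (F ∘ swap) ≡ size F
size-transpose F = ℕ.+-comm (countFin (F ∘ inj₂)) (countFin (F ∘ inj₁))

opposite-injective : Injective _≡_ _≡_ (opposite {k})
opposite-injective {x = i} {j} e =
  trans (sym (Fin.opposite-involutive i)) (trans (cong opposite e) (Fin.opposite-involutive j))

opposite-reverses-< : {i j : Fin k} → i < j → opposite j < opposite i
opposite-reverses-< {i = i} {j} i<j = subst₂ Nat._<_ (sym (Fin.opposite-prop j)) (sym (Fin.opposite-prop i))
  (ℕ.∸-monoʳ-< (s≤s i<j) (Fin.toℕ<n j))

IsTriangle-transpose : (Y : Pattern m n) → IsTriangle (Y ᵀ) k → IsTriangle Y k
IsTriangle-transpose Y (ρ , γ , ρ-inj , γ-inj , diag , upper) =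
  γ ∘ opposite , ρ ∘ opposite , opposite-injective ∘ γ-inj , opposite-injective ∘ ρ-inj ,
  diag ∘ opposite , λ i j i<j → upper (opposite j) (opposite i) (opposite-reverses-< i<j)

zeroForcingSet⇒triangle : (Y : Pattern m n) {F : Vertex m n → Bool} → Saturated Y → ZeroForcingSet Y F →
                          ∃ λ k → IsTriangle Y k × k + size F ≡ m + n
zeroForcingSet⇒triangle {m} {n} Y {F} sat zfs with zeroForcingSet-full-or-forces zfs
... | inj₁ full                = 0 , emptyTriangle Y , size-full F full
... | inj₂ (inj₁ r , _ , r⇒x) = row-forcing⇒triangle Y sat zfs r⇒x
... | inj₂ (inj₂ c , _ , c⇒x)
  with row-forcing⇒triangle (Y ᵀ) (proj₂ sat , proj₁ sat) (zeroForcingSet-transpose zfs) (Forces-transpose c⇒x)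
... | k , Tᵀ , k+|Fᵀ|≡ =
  k , IsTriangle-transpose Y Tᵀ , trans (cong (k +_) (sym (size-transpose F))) (trans k+|Fᵀ|≡ (ℕ.+-comm n m))

zeroForcingSet-size-≥ : (Y : Pattern m n) {F : Vertex m n → Bool} → Saturated Y → Tri Y t →
                        ZeroForcingSet Y F → m + n ∸ t ≤ size F
zeroForcingSet-size-≥ {m} {n} {t} Y {F} sat (_ , maximal) zfs with zeroForcingSet⇒triangle Y sat zfs
... | k , Tₖ , k+|F|≡ = begin
  m + n ∸ t      ≤⟨ ℕ.∸-monoʳ-≤ (m + n) (maximal k Tₖ) ⟩
  m + n ∸ k      ≡⟨ cong (_∸ k) k+|F|≡ ⟨
  k + size F ∸ k ≡⟨ ℕ.m+n∸m≡n k (size F) ⟩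
  size F         ∎
  where open ℕ.≤-Reasoning

inImage : (Fin t → Fin n) → Fin n → Bool
inImage γ j = does (Fin.any? λ i → γ i Fin.≟ j)

inImage-sound : (γ : Fin t → Fin n) (j : Fin n) → inImage γ j ≡ true → ∃ λ i → γ i ≡ j
inImage-sound γ j e with Fin.any? (λ i → γ i Fin.≟ j)
inImage-sound γ j _  | yes found = found
inImage-sound γ j () | no _

inImage-complete : (γ : Fin t → Fin n) (i : Fin t) → inImage γ (γ i) ≡ true
inImage-complete γ i = dec-true (Fin.any? λ i′ → γ i′ Fin.≟ γ i) (i , refl)

module _ (Y : Pattern m n) where

  triangleForcingSet : IsTriangle Y t → Vertex m n → Bool
  triangleForcingSet T (inj₁ _) = true
  triangleForcingSet T (inj₂ j) = not (inImage (triangleColumns Y T) j)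

  triangleForcingSet-zeroForcing : (T : IsTriangle Y t) → ZeroForcingSet Y (triangleForcingSet T)
  triangleForcingSet-zeroForcing T@(ρ , γ , _ , _ , diag , upper) = λ
    { (inj₁ _) → initial refl
    ; (inj₂ j) → column-filled j λ { i refl → triangle-column-filled i (<-wellFounded i) } }
    where
    F₀ = triangleForcingSet T
    column-filled : ∀ j → (∀ i → γ i ≡ j → Filled Y F₀ (inj₂ j)) → Filled Y F₀ (inj₂ j)
    column-filled j filled-if-in-triangle with inImage γ j in e
    ... | false = initial (cong not e)
    ... | true  = uncurry filled-if-in-triangle (inImage-sound γ j e)
    triangle-column-filled : ∀ i → Acc _<_ i → Filled Y F₀ (inj₂ (γ i))
    triangle-column-filled i (acc earlier) = force {u = inj₁ (ρ i)} (initial refl) (diag i) λ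
      { (inj₁ _) _ _       → initial refl
      ; (inj₂ j) ρᵢj j≢γᵢ → column-filled j λ { i′ refl → earlier-filled i′ ρᵢj j≢γᵢ } }
      where
      earlier-filled : ∀ i′ → Y (ρ i) (γ i′) ≡ true → inj₂ (γ i′) ≢ inj₂ (γ i) → Filled Y F₀ (inj₂ (γ i′))
      earlier-filled i′ ρᵢγᵢ′ γᵢ′≢γᵢ with Fin.<-cmp i′ i
      ... | tri< i′<i _ _ = triangle-column-filled i′ (earlier i′<i)
      ... | tri≈ _ refl _ = contradiction refl γᵢ′≢γᵢ
      ... | tri> _ _ i<i′ = contradiction ρᵢγᵢ′ (Bool.not-¬ (upper i i′ i<i′))

  size-triangleForcingSet : (T : IsTriangle Y t) → size (triangleForcingSet T) ≤ m + n ∸ t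
  size-triangleForcingSet {t} T@(_ , γ , _ , γ-inj , _) = begin
    size (triangleForcingSet T)     ≡⟨ cong (_+ outside) (countFin-full (λ _ → true) λ _ → refl) ⟩
    m + outside                     ≡⟨ cong (m +_) (ℕ.m+n∸n≡m outside inside) ⟨
    m + (outside + inside ∸ inside) ≡⟨ cong (λ k → m + (k ∸ inside)) (countFin-not (inImage γ)) ⟩
    m + (n ∸ inside)                ≤⟨ ℕ.+-monoʳ-≤ m (ℕ.∸-monoʳ-≤ n t≤inside) ⟩
    m + (n ∸ t)                     ≡⟨ ℕ.+-∸-assoc m (ℕ.≤-trans t≤inside (countFin-≤ (inImage γ))) ⟨
    m + n ∸ t                       ∎
    where
    open ℕ.≤-Reasoning
    inside  = countFin (inImage γ)
    outside = countFin (not ∘ inImage γ)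
    t≤inside : t ≤ inside
    t≤inside = countFin-injection (inImage γ) γ γ-inj (inImage-complete γ)

theorem4p8 : ∀ (m n : ℕ) (Y : Pattern m n) → Saturated Y →
    ∀ t → Tri Y t → ZeroForcingNumber Y (m + n ∸ t)
theorem4p8 m n Y sat t tri@(T , _) =
  (F₀ , F₀-zfs , ℕ.≤-antisym (size-triangleForcingSet Y T) (zeroForcingSet-size-≥ Y sat tri F₀-zfs)) ,
  λ _ → zeroForcingSet-size-≥ Y sat tri
  where
  F₀     = triangleForcingSet Y T
  F₀-zfs = triangleForcingSet-zeroForcing Y T
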